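{- Let $\mathcal I=\lambda x\,\mu\alpha\,x$, $\mathcal C=\lambda x\,\mu\alpha\,(x\;\alpha)$ and $\mathcal P=\lambda x\,\mu\alpha\,(\alpha\;(x\;\alpha))$. Then: (1) $\vdash'\mathcal I:\forall X\,\{\perp\rightarrow X\}$, and for all $\lambda\mu^{++}$-terms $t,t_1,\dots,t_n$, $(\mathcal I\;t\;t_1\dots t_n)\rightharpoonup_{\mu^{++}}\mu\alpha\,t$; (2) $\vdash'\mathcal C:\forall X\,\{\neg\neg X\rightarrow X\}$, and for all $t,t_1,\dots,t_n$, $(\mathcal C\;t\;t_1\dots t_n)\rightharpoonup_{\mu^{++}}\mu\alpha\,(t\;\lambda y\,(\alpha\;(y\;t_1\dots t_n)))$; (3) $\vdash'\mathcal P:\forall X\,\{(\neg X\rightarrow X)\rightarrow X\}$, and for all $t,t_1,\dots,t_n$, $(\mathcal P\;t\;t_1\dots t_n)\rightharpoonup_{\mu^{++}}\mu\alpha\,(\alpha\;(t\;\lambda y\,(\alpha\;(y\;t_1\dots t_n)))\;t_1\dots t_n)$. (Here $\alpha,y$ are chosen not free in $t,t_1,\dots,t_n$.)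
   Context: $\lambda\mu^{++}$-terms: $t ::= x\mid\alpha\mid\lambda x\,t\mid\mu\alpha\,t\mid(t\;t)$ ($x$ $\lambda$-variables, $\alpha$ $\mu$-variables; binders $\lambda,\mu$; $(t\;t_1\dots t_n)=(\dots(t\;t_1)\dots t_n)$). $\mathbf{id}=\lambda x\,x$. One-step reduction $\rightharpoonup$ is the contextual closure of: $(C_\lambda)$ $(\lambda x\,u\;v)\rightharpoonup u[x:=v]$; $(C_\mu)$ $(\mu\alpha\,u\;v)\rightharpoonup\mu\beta\,u[\alpha:=\lambda y\,(\beta\;(y\;v))]$; $(S_1)$ $((\alpha\;u)\;v)\rightharpoonup(\alpha\;u)$; $(S_2)$ $\mu\alpha\mu\beta\,u\rightharpoonup\mu\alpha\,u[\beta:=\mathbf{id}]$; $(S_3)$ $(\alpha\;(\beta\;u))\rightharpoonup(\beta\;u)$; $(S_4)$ $(\beta\;\mu\alpha\,u)\rightharpoonup u[\alpha:=\lambda y\,(\beta\;y)]$; $(S_5)$ $\mu\alpha\,u\rightharpoonup\lambda z\,\mu\beta\,u[\alpha:=\lambda y\,(\beta\;(y\;z))]$ if $u$ contains a subterm $(\alpha\;\lambda x\,v)$; $(S_6)$ $\mu\alpha\,u[y:=(\alpha\;v)]\rightharpoonup v$ if $y$ is free in $u$ and $\alpha$ not free in $v$. $t\rightharpoonup_{\mu^{++}}t'$: finitely many steps. Types: second-order formulas with $\perp,\rightarrow,\forall x,\forall X$; $\neg A=A\rightarrow\perp$; $\{A_1\rightarrow A\}$ is $A_1\rightarrow A$.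 Typing $\Gamma\vdash' t:A$ (contexts $x_1:A_1,\dots,x_n:A_n,\alpha_1:\neg B_1,\dots,\alpha_m:\neg B_m$) is generated by: (1) $\Gamma\vdash' x_i:A_i$, $\Gamma\vdash'\alpha_j:\neg B_j$; (2) from $\Gamma,x:A\vdash' u:B$ infer $\Gamma\vdash'\lambda x\,u:A\rightarrow B$; (3) from $\Gamma_1\vdash' u:A\rightarrow B$, $\Gamma_2\vdash' v:A$ infer $\Gamma_1,\Gamma_2\vdash'(u\;v):B$; (4) from $\Gamma\vdash' u:A$, $x$ not free in $\Gamma$, infer $\Gamma\vdash' u:\forall x\,A$; (5) from $\Gamma\vdash' u:\forall x\,A$ infer $\Gamma\vdash' u:A[x:=a]$; (6) from $\Gamma\vdash' u:A$, $X$ not free in $\Gamma$, infer $\Gamma\vdash' u:\forall X\,A$; (7) from $\Gamma\vdash' u:\forall X\,A$ infer $\Gamma\vdash' u:A[X:=G]$; (8) from $\Gamma\vdash' u:A[x:=a]$ and $a\approx_E b$ infer $\Gamma\vdash' u:A[x:=b]$ (for a fixed set $E$ of equations, $\approx_E$ the induced equivalence); (9) from $\Gamma,\alpha:\neg B\vdash' u:\perp$ infer $\Gamma\vdash'\mu\alpha\,u:B$. -}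

module Defs where

open import Data.Nat using (ℕ; zero; suc; _+_)
open import Data.Fin using (Fin; zero; suc; _↑ˡ_; _↑ʳ_; splitAt)
open import Data.Sum using ([_,_]′)
open import Data.Vec using (Vec; []; _∷_; lookup; tabulate)
open import Data.Vec.Relation.Binary.Pointwise.Inductive using (Pointwise)
open import Data.List using (List; []; _∷_; foldl)
open import Data.List.Membership.Propositional using (_∈_)
open import Data.List.Relation.Unary.Any using (here; there)
open import Relation.Binary.PropositionalEquality using (_≡_; refl)
open import Relation.Binary.Construct.Closure.ReflexiveTransitive using (Star)

-- First-order terms (de Bruijn, scoped by the number m of free variables).
-- Function symbols: a symbol is a name f : ℕ together with an arity k.

data Tm (m : ℕ) : Set where
  var : Fin m → Tm m
  fun : (f : ℕ) {k : ℕ} → Vec (Tm m) k → Tm m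

mutual
  substT : ∀ {m m'} → (Fin m → Tm m') → Tm m → Tm m'
  substT σ (var i)    = σ i
  substT σ (fun f ts) = fun f (substTs σ ts)

  substTs : ∀ {m m' k} → (Fin m → Tm m') → Vec (Tm m) k → Vec (Tm m') k
  substTs σ []       = []
  substTs σ (t ∷ ts) = substT σ t ∷ substTs σ ts

renT : ∀ {m m'} → (Fin m → Fin m') → Tm m → Tm m'
renT ρ = substT (λ i → var (ρ i))

liftF : ∀ {m m'} → (Fin m → Fin m') → Fin (suc m) → Fin (suc m')
liftF ρ zero    = zero
liftF ρ (suc i) = suc (ρ i)

liftT : ∀ {m m'} → (Fin m → Tm m') → Fin (suc m) → Tm (suc m')
liftT σ zero    = var zero
liftT σ (suc i) = renT suc (σ i)

-- Second-order formulas with ⊥, →, ∀x, ∀X.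
-- Δ : list of arities of the free second-order variables,
-- m : number of free first-order variables.

data Fm (Δ : List ℕ) (m : ℕ) : Set where
  ⊥'   : Fm Δ m
  _⇒_  : Fm Δ m → Fm Δ m → Fm Δ m
  ∀₁   : Fm Δ (suc m) → Fm Δ m                -- ∀x A   (x = variable 0)
  ∀₂   : (n : ℕ) → Fm (n ∷ Δ) m → Fm Δ m      -- ∀X A   (X of arity n, X = here)
  atom : ∀ {n} → n ∈ Δ → Vec (Tm m) n → Fm Δ m

infixr 5 _⇒_

¬' : ∀ {Δ m} → Fm Δ m → Fm Δ m
¬' A = A ⇒ ⊥'

substF1 : ∀ {Δ m m'} → (Fin m → Tm m') → Fm Δ m → Fm Δ m'
substF1 σ ⊥'          = ⊥'
substF1 σ (A ⇒ B)     = substF1 σ A ⇒ substF1 σ B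
substF1 σ (∀₁ A)      = ∀₁ (substF1 (liftT σ) A)
substF1 σ (∀₂ n A)    = ∀₂ n (substF1 σ A)
substF1 σ (atom X as) = atom X (substTs σ as)

renF1 : ∀ {Δ m m'} → (Fin m → Fin m') → Fm Δ m → Fm Δ m'
renF1 ρ = substF1 (λ i → var (ρ i))

Ren2 : List ℕ → List ℕ → Set
Ren2 Δ Δ' = ∀ {n} → n ∈ Δ → n ∈ Δ'

lift2 : ∀ {Δ Δ' k} → Ren2 Δ Δ' → Ren2 (k ∷ Δ) (k ∷ Δ')
lift2 ρ (here p)  = here p
lift2 ρ (there x) = there (ρ x)

renF2 : ∀ {Δ Δ' m} → Ren2 Δ Δ' → Fm Δ m → Fm Δ' m
renF2 ρ ⊥'          = ⊥'
renF2 ρ (A ⇒ B)     = renF2 ρ A ⇒ renF2 ρ B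
renF2 ρ (∀₁ A)      = ∀₁ (renF2 ρ A)
renF2 ρ (∀₂ n A)    = ∀₂ n (renF2 (lift2 ρ) A)
renF2 ρ (atom X as) = atom (ρ X) as

-- Second-order substitution: a variable X of arity n is replaced by a
-- "comprehension" G : Fm Δ' (n + m), whose first-order variables
-- i ↑ˡ m (i : Fin n) are the n parameters and n ↑ʳ j (j : Fin m) are the
-- ambient free first-order variables.
Sub2 : List ℕ → List ℕ → ℕ → Set
Sub2 Δ Δ' m = ∀ {n} → n ∈ Δ → Fm Δ' (n + m)

idVal : ∀ {Δ n m} → n ∈ Δ → Fm Δ (n + m)
idVal {n = n} {m} X = atom X (tabulate (λ i → var (i ↑ˡ m)))

inst : ∀ {n m} → Vec (Tm m) n → Fin (n + m) → Tm m
inst {n} as i = [ lookup as , var ]′ (splitAt n i)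

-- weakening a comprehension under a first-order binder
wkParam : ∀ {n m} → Fin (n + m) → Fin (n + suc m)
wkParam {n} {m} i = [ (λ a → a ↑ˡ suc m) , (λ j → n ↑ʳ suc j) ]′ (splitAt n i)

lift2S1 : ∀ {Δ Δ' m} → Sub2 Δ Δ' m → Sub2 Δ Δ' (suc m)
lift2S1 σ X = renF1 wkParam (σ X)

lift2S2 : ∀ {Δ Δ' m k} → Sub2 Δ Δ' m → Sub2 (k ∷ Δ) (k ∷ Δ') m
lift2S2 σ (here refl) = idVal (here refl)
lift2S2 σ (there X)   = renF2 there (σ X)

substF2 : ∀ {Δ Δ' m} → Sub2 Δ Δ' m → Fm Δ m → Fm Δ' m
substF2 σ ⊥'          = ⊥'
substF2 σ (A ⇒ B)     = substF2 σ A ⇒ substF2 σ B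
substF2 σ (∀₁ A)      = ∀₁ (substF2 (lift2S1 σ) A)
substF2 σ (∀₂ n A)    = ∀₂ n (substF2 (lift2S2 σ) A)
substF2 σ (atom X as) = substF1 (inst as) (σ X)

_[_]₁ : ∀ {Δ m} → Fm Δ (suc m) → Tm m → Fm Δ m
A [ a ]₁ = substF1 σ A
  where
  σ : Fin (suc _) → Tm _
  σ zero    = a
  σ (suc i) = var i

_[_]₂ : ∀ {Δ m n} → Fm (n ∷ Δ) m → Fm Δ (n + m) → Fm Δ m
_[_]₂ {Δ} {m} A G = substF2 σ A
  where
  σ : Sub2 (_ ∷ Δ) Δ m
  σ (here refl) = G
  σ (there X)   = idVal X

-- weakenings of formulas (for the freshness side conditions of rules 4, 6)
wk1 : ∀ {Δ m} → Fm Δ m → Fm Δ (suc m)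
wk1 = renF1 suc

wk2 : ∀ {Δ m n} → Fm Δ m → Fm (n ∷ Δ) m
wk2 = renF2 there

Eqs : Set₁
Eqs = ∀ {k} → Tm k → Tm k → Set

data _⊢_≈_ (E : Eqs) {m : ℕ} : Tm m → Tm m → Set where
  ax     : ∀ {k} {p q : Tm k} (σ : Fin k → Tm m) → E p q →
           E ⊢ substT σ p ≈ substT σ q
  refl≈  : ∀ {a} → E ⊢ a ≈ a
  sym≈   : ∀ {a b} → E ⊢ a ≈ b → E ⊢ b ≈ a
  trans≈ : ∀ {a b c} → E ⊢ a ≈ b → E ⊢ b ≈ c → E ⊢ a ≈ c
  cong≈  : ∀ f {k} {as bs : Vec (Tm m) k} →
           Pointwise (E ⊢_≈_) as bs → E ⊢ fun f as ≈ fun f bs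

-- λμ⁺⁺-terms, de Bruijn, scoped: l λ-variables, k μ-variables.

data Λ (l k : ℕ) : Set where
  xv  : Fin l → Λ l k
  αv  : Fin k → Λ l k           -- μ-variable α (used as a term)
  lam : Λ (suc l) k → Λ l k
  mu  : Λ l (suc k) → Λ l k
  _·_ : Λ l k → Λ l k → Λ l k

infixl 7 _·_

apps : ∀ {l k} → Λ l k → List (Λ l k) → Λ l k
apps = foldl _·_

ren : ∀ {l l' k k'} → (Fin l → Fin l') → (Fin k → Fin k') → Λ l k → Λ l' k'
ren ρ τ (xv i)  = xv (ρ i)
ren ρ τ (αv j)  = αv (τ j)
ren ρ τ (lam t) = lam (ren (liftF ρ) τ t)
ren ρ τ (mu t)  = mu (ren ρ (liftF τ) t)
ren ρ τ (t · u) = ren ρ τ t · ren ρ τ u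

wkλ : ∀ {l k} → Λ l k → Λ (suc l) k
wkλ = ren suc (λ j → j)

wkμ : ∀ {l k} → Λ l k → Λ l (suc k)
wkμ = ren (λ i → i) suc

wkλμ : ∀ {l k} → Λ l k → Λ (suc l) (suc k)
wkλμ = ren suc suc

sub : ∀ {l l' k k'} → (Fin l → Λ l' k') → (Fin k → Λ l' k') → Λ l k → Λ l' k'
sub σ τ (xv i)  = σ i
sub σ τ (αv j)  = τ j
sub σ τ (lam t) = lam (sub σ' (λ j → wkλ (τ j)) t)
  where
  σ' : Fin (suc _) → Λ (suc _) _
  σ' zero    = xv zero
  σ' (suc i) = wkλ (σ i)
sub σ τ (mu t)  = mu (sub (λ i → wkμ (σ i)) τ' t)
  where
  τ' : Fin (suc _) → Λ _ (suc _)
  τ' zero    = αv zero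
  τ' (suc j) = wkμ (τ j)
sub σ τ (t · u) = sub σ τ t · sub σ τ u

_[_]λ : ∀ {l k} → Λ (suc l) k → Λ l k → Λ l k
u [ v ]λ = sub σ αv u
  where
  σ : Fin (suc _) → Λ _ _
  σ zero    = v
  σ (suc i) = xv i

𝐢𝐝 : ∀ {l k} → Λ l k
𝐢𝐝 = lam (xv zero)

data HasαLam : ∀ {l k} → Fin k → Λ l k → Set where
  hit : ∀ {l k a} {v : Λ (suc l) k} → HasαLam a (αv a · lam v)
  inλ : ∀ {l k a} {u : Λ (suc l) k} → HasαLam a u → HasαLam a (lam u)
  inμ : ∀ {l k a} {u : Λ l (suc k)} → HasαLam (suc a) u → HasαLam a (mu u)
  inl : ∀ {l k a} {u v : Λ l k} → HasαLam a u → HasαLam a (u · v)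
  inr : ∀ {l k a} {u v : Λ l k} → HasαLam a v → HasαLam a (u · v)

data FreeX : ∀ {l k} → Fin l → Λ l k → Set where
  hit : ∀ {l k i} → FreeX {l} {k} i (xv i)
  inλ : ∀ {l k i} {u : Λ (suc l) k} → FreeX (suc i) u → FreeX i (lam u)
  inμ : ∀ {l k i} {u : Λ l (suc k)} → FreeX i u → FreeX i (mu u)
  inl : ∀ {l k i} {u v : Λ l k} → FreeX i u → FreeX i (u · v)
  inr : ∀ {l k i} {u v : Λ l k} → FreeX i v → FreeX i (u · v)

data _⟶_ : ∀ {l k} → Λ l k → Λ l k → Set where
  Cλ : ∀ {l k} (u : Λ (suc l) k) (v : Λ l k) →
       lam u · v ⟶ u [ v ]λ
  -- (μα u v) ⇀ μβ u[α:=λy(β (y v))]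
  Cμ : ∀ {l k} (u : Λ l (suc k)) (v : Λ l k) →
       let τ : Fin (suc k) → Λ l (suc k)
           τ = λ { zero → lam (αv zero · (xv zero · wkλμ v)) ; (suc j) → αv (suc j) }
       in mu u · v ⟶ mu (sub xv τ u)
  S1 : ∀ {l k} (a : Fin k) (u v : Λ l k) →
       (αv a · u) · v ⟶ αv a · u
  -- μα μβ u ⇀ μα u[β:=id]
  S2 : ∀ {l k} (u : Λ l (suc (suc k))) →
       let τ : Fin (suc (suc k)) → Λ l (suc k)
           τ = λ { zero → 𝐢𝐝 ; (suc j) → αv j }
       in mu (mu u) ⟶ mu (sub xv τ u)
  S3 : ∀ {l k} (a b : Fin k) (u : Λ l k) →
       αv a · (αv b · u) ⟶ αv b · u
  -- (β μα u) ⇀ u[α:=λy(β y)]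
  S4 : ∀ {l k} (b : Fin k) (u : Λ l (suc k)) →
       let τ : Fin (suc k) → Λ l k
           τ = λ { zero → lam (αv b · xv zero) ; (suc j) → αv j }
       in αv b · mu u ⟶ sub xv τ u
  -- μα u ⇀ λz μβ u[α:=λy(β (y z))]   if u contains (α λx v)
  S5 : ∀ {l k} (u : Λ l (suc k)) → HasαLam zero u →
       let τ : Fin (suc k) → Λ (suc l) (suc k)
           τ = λ { zero → lam (αv zero · (xv zero · xv (suc zero))) ; (suc j) → αv (suc j) }
       in mu u ⟶ lam (mu (sub (λ i → xv (suc i)) τ u))
  -- μα u[y:=(α v)] ⇀ v   if y free in u and α not free in v
  -- (y is the λ-variable 0 of u; α ∉ FV(v) is expressed by v : Λ l k)
  S6 : ∀ {l k} (u : Λ (suc l) (suc k)) (v : Λ l k) → FreeX zero u →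
       mu (u [ αv zero · wkμ v ]λ) ⟶ v
  ξλ  : ∀ {l k} {u u' : Λ (suc l) k} → u ⟶ u' → lam u ⟶ lam u'
  ξμ  : ∀ {l k} {u u' : Λ l (suc k)} → u ⟶ u' → mu u ⟶ mu u'
  ξ·ₗ : ∀ {l k} {u u' v : Λ l k} → u ⟶ u' → u · v ⟶ u' · v
  ξ·ᵣ : ∀ {l k} {u v v' : Λ l k} → v ⟶ v' → u · v ⟶ u · v'

infix 4 _⟶_ _⟶*_

_⟶*_ : ∀ {l k} → Λ l k → Λ l k → Set
_⟶*_ = Star _⟶_

-- Typing  Γ ⊢' t : A.  Γ assigns A_i to the λ-variables, Θ assigns B_j
-- to the μ-variables (α_j : ¬B_j).

ext : ∀ {n} {A : Set} → A → (Fin n → A) → Fin (suc n) → A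
ext a f zero    = a
ext a f (suc i) = f i

∅ : ∀ {A : Set} → Fin 0 → A
∅ ()

data Typed (E : Eqs) : ∀ {Δ m l k} → (Fin l → Fm Δ m) → (Fin k → Fm Δ m) →
                       Λ l k → Fm Δ m → Set where
  axx   : ∀ {Δ m l k} {Γ : Fin l → Fm Δ m} {Θ : Fin k → Fm Δ m} (i : Fin l) →
          Typed E Γ Θ (xv i) (Γ i)
  axα   : ∀ {Δ m l k} {Γ : Fin l → Fm Δ m} {Θ : Fin k → Fm Δ m} (j : Fin k) →
          Typed E Γ Θ (αv j) (¬' (Θ j))
  →I    : ∀ {Δ m l k} {Γ : Fin l → Fm Δ m} {Θ : Fin k → Fm Δ m} {A B u} →
          Typed E (ext A Γ) Θ u B → Typed E Γ Θ (lam u) (A ⇒ B)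
  →E    : ∀ {Δ m l k} {Γ : Fin l → Fm Δ m} {Θ : Fin k → Fm Δ m} {A B u v} →
          Typed E Γ Θ u (A ⇒ B) → Typed E Γ Θ v A → Typed E Γ Θ (u · v) B
  -- (4)  (x not free in Γ: Γ is weakened into the extended scope)
  ∀₁I   : ∀ {Δ m l k} {Γ : Fin l → Fm Δ m} {Θ : Fin k → Fm Δ m} {A u} →
          Typed E (λ i → wk1 (Γ i)) (λ j → wk1 (Θ j)) u A → Typed E Γ Θ u (∀₁ A)
  ∀₁E   : ∀ {Δ m l k} {Γ : Fin l → Fm Δ m} {Θ : Fin k → Fm Δ m} {A u} →
          Typed E Γ Θ u (∀₁ A) → (a : Tm m) → Typed E Γ Θ u (A [ a ]₁)
  -- (6)  (X not free in Γ)
  ∀₂I   : ∀ {Δ m l k} {Γ : Fin l → Fm Δ m} {Θ : Fin k → Fm Δ m} {n A u} →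
          Typed E (λ i → wk2 {n = n} (Γ i)) (λ j → wk2 (Θ j)) u A →
          Typed E Γ Θ u (∀₂ n A)
  ∀₂E   : ∀ {Δ m l k} {Γ : Fin l → Fm Δ m} {Θ : Fin k → Fm Δ m} {n A u} →
          Typed E Γ Θ u (∀₂ n A) → (G : Fm Δ (n + m)) → Typed E Γ Θ u (A [ G ]₂)
  eqE   : ∀ {Δ m l k} {Γ : Fin l → Fm Δ m} {Θ : Fin k → Fm Δ m} {u}
          (A : Fm Δ (suc m)) {a b : Tm m} →
          Typed E Γ Θ u (A [ a ]₁) → E ⊢ a ≈ b → Typed E Γ Θ u (A [ b ]₁)
  μI    : ∀ {Δ m l k} {Γ : Fin l → Fm Δ m} {Θ : Fin k → Fm Δ m} {B u} →
          Typed E Γ (ext B Θ) u ⊥' → Typed E Γ Θ (mu u) B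

𝓘 𝓒 𝓟 : ∀ {l k} → Λ l k
𝓘 = lam (mu (xv zero))
𝓒 = lam (mu (xv zero · αv zero))
𝓟 = lam (mu (αv zero · (xv zero · αv zero)))

-- X as a formula, in the scope of ∀X (X of arity 0)
X₀ : Fm (0 ∷ []) 0
X₀ = atom (here refl) []

-- After the initial β-step each of 𝓘 t, 𝓒 t, 𝓟 t is a μ-abstraction, and every further
-- argument v is swallowed by one Cμ-step, which replaces α by λy (α (y v)). This leaves μα t
-- untouched, and it turns the continuation λy (α (y t₁ … tₙ)) into λy (α (y t₁ … tₙ v)) after
-- one β-step under the binder. The reductions therefore follow from a single-argument
-- absorption step by induction on the argument list.

module Submission where

open import Defs
open import Data.Fin using (Fin; zero; suc)
open import Data.Nat using (suc)
open import Data.List using (List; []; _∷_; [_]; map; _++_; _∷ʳ_)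
open import Data.List.Properties using (map-++; map-∘; map-cong; foldl-∷ʳ; ++-identityʳ; ∷ʳ-++)
open import Data.Product using (_×_; _,_)
open import Function using (id; _∘_)
open import Relation.Binary.PropositionalEquality using (_≡_; refl; sym; trans; cong; cong₂; subst)
open import Relation.Binary.Construct.Closure.ReflexiveTransitive using (ε; _◅_; _◅◅_; gmap)
open import Relation.Binary.Construct.Closure.ReflexiveTransitive.Properties using (module StarReasoning)

liftF-∘ : ∀ {a b c} {ρ : Fin b → Fin c} {π : Fin a → Fin b} {κ : Fin a → Fin c} →
          (∀ i → ρ (π i) ≡ κ i) → ∀ i → liftF ρ (liftF π i) ≡ liftF κ i
liftF-∘ h zero    = refl
liftF-∘ h (suc i) = cong suc (h i)

ren∘ren : ∀ {l₁ l₂ l₃ k₁ k₂ k₃}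
            {ρ : Fin l₂ → Fin l₃} {ρ′ : Fin k₂ → Fin k₃} {π : Fin l₁ → Fin l₂} {π′ : Fin k₁ → Fin k₂}
            {κ : Fin l₁ → Fin l₃} {κ′ : Fin k₁ → Fin k₃} (t : Λ l₁ k₁) →
          (∀ i → ρ (π i) ≡ κ i) → (∀ j → ρ′ (π′ j) ≡ κ′ j) →
          ren ρ ρ′ (ren π π′ t) ≡ ren κ κ′ t
ren∘ren (xv i)  h h′ = cong xv (h i)
ren∘ren (αv j)  h h′ = cong αv (h′ j)
ren∘ren (lam t) h h′ = cong lam (ren∘ren t (liftF-∘ h) h′)
ren∘ren (mu t)  h h′ = cong mu (ren∘ren t h (liftF-∘ h′))
ren∘ren (t · u) h h′ = cong₂ _·_ (ren∘ren t h h′) (ren∘ren u h h′)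

sub∘ren : ∀ {l₁ l₂ l₃ k₁ k₂ k₃}
            {σ : Fin l₂ → Λ l₃ k₃} {τ : Fin k₂ → Λ l₃ k₃} {ρ : Fin l₁ → Fin l₂} {ρ′ : Fin k₁ → Fin k₂}
            {π : Fin l₁ → Fin l₃} {π′ : Fin k₁ → Fin k₃} (t : Λ l₁ k₁) →
          (∀ i → σ (ρ i) ≡ xv (π i)) → (∀ j → τ (ρ′ j) ≡ αv (π′ j)) →
          sub σ τ (ren ρ ρ′ t) ≡ ren π π′ t
sub∘ren (xv i)  h h′ = h i
sub∘ren (αv j)  h h′ = h′ j
sub∘ren (lam t) h h′ =
  cong lam (sub∘ren t (λ { zero → refl ; (suc i) → cong wkλ (h i) }) (cong wkλ ∘ h′))
sub∘ren (mu t)  h h′ =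
  cong mu (sub∘ren t (cong wkμ ∘ h) (λ { zero → refl ; (suc j) → cong wkμ (h′ j) }))
sub∘ren (t · u) h h′ = cong₂ _·_ (sub∘ren t h h′) (sub∘ren u h h′)

map-sub∘ren : ∀ {l₁ l₂ l₃ k₁ k₂ k₃}
                {σ : Fin l₂ → Λ l₃ k₃} {τ : Fin k₂ → Λ l₃ k₃} {ρ : Fin l₁ → Fin l₂} {ρ′ : Fin k₁ → Fin k₂}
                {π : Fin l₁ → Fin l₃} {π′ : Fin k₁ → Fin k₃} →
              (∀ i → σ (ρ i) ≡ xv (π i)) → (∀ j → τ (ρ′ j) ≡ αv (π′ j)) →
              ∀ ts → map (sub σ τ) (map (ren ρ ρ′) ts) ≡ map (ren π π′) ts
map-sub∘ren h h′ ts = trans (sym (map-∘ ts)) (map-cong (λ t → sub∘ren t h h′) ts)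

sub-cong : ∀ {l l′ k k′} {σ₁ σ₂ : Fin l → Λ l′ k′} {τ₁ τ₂ : Fin k → Λ l′ k′} (t : Λ l k) →
           (∀ i → σ₁ i ≡ σ₂ i) → (∀ j → τ₁ j ≡ τ₂ j) → sub σ₁ τ₁ t ≡ sub σ₂ τ₂ t
sub-cong (xv i)  h h′ = h i
sub-cong (αv j)  h h′ = h′ j
sub-cong (lam t) h h′ =
  cong lam (sub-cong t (λ { zero → refl ; (suc i) → cong wkλ (h i) }) (cong wkλ ∘ h′))
sub-cong (mu t)  h h′ =
  cong mu (sub-cong t (cong wkμ ∘ h) (λ { zero → refl ; (suc j) → cong wkμ (h′ j) }))
sub-cong (t · u) h h′ = cong₂ _·_ (sub-cong t h h′) (sub-cong u h h′)

sub-apps : ∀ {l l′ k k′} (σ : Fin l → Λ l′ k′) (τ : Fin k → Λ l′ k′) (u : Λ l k) (ws : List (Λ l k)) →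
           sub σ τ (apps u ws) ≡ apps (sub σ τ u) (map (sub σ τ) ws)
sub-apps σ τ u []       = refl
sub-apps σ τ u (w ∷ ws) = sub-apps σ τ (u · w) ws

apps-map-∷ʳ : ∀ {A : Set} {l k} (f : A → Λ l k) (u : Λ l k) (ws : List A) (w : A) →
              apps u (map f (ws ∷ʳ w)) ≡ apps u (map f ws) · f w
apps-map-∷ʳ f u ws w = trans (cong (apps u) (map-++ f ws [ w ])) (foldl-∷ʳ _·_ u (f w) (map f ws))

apps-⟶ : ∀ {l k} {u u′ : Λ l k} (ws : List (Λ l k)) → u ⟶ u′ → apps u ws ⟶ apps u′ ws
apps-⟶ []       p = p
apps-⟶ (w ∷ ws) p = apps-⟶ ws (ξ·ₗ p)

apps-⟶* : ∀ {l k} {u u′ : Λ l k} (ws : List (Λ l k)) → u ⟶* u′ → apps u ws ⟶* apps u′ ws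
apps-⟶* ws = gmap (λ u → apps u ws) (apps-⟶ ws)

apps-absorb : ∀ {l k} (F : List (Λ l k) → Λ l k) →
              (∀ us v → F us · v ⟶* F (us ∷ʳ v)) →
              ∀ us vs → apps (F us) vs ⟶* F (us ++ vs)
apps-absorb F step us [] rewrite ++-identityʳ us = ε
apps-absorb F step us (v ∷ vs) rewrite sym (∷ʳ-++ us v vs) =
  apps-⟶* vs (step us v) ◅◅ apps-absorb F step (us ∷ʳ v) vs

-- The substitution α := λy (α (y v)) of rule Cμ.
passArg : ∀ {l k} → Λ l k → Fin (suc k) → Λ l (suc k)
passArg v zero    = lam (αv zero · (xv zero · wkλμ v))
passArg v (suc j) = αv (suc j)

-- Rule Cμ states its substitution as an anonymous pattern lambda, equal to passArg v only pointwise.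
Cμ-passArg : ∀ {l k} (u : Λ l (suc k)) (v : Λ l k) → mu u · v ⟶ mu (sub xv (passArg v) u)
Cμ-passArg u v =
  subst (λ w → mu u · v ⟶ mu w)
        (sub-cong u (λ _ → refl) (λ { zero → refl ; (suc j) → refl }))
        (Cμ u v)

passArg-wkμ : ∀ {l k} (v t : Λ l k) → sub xv (passArg v) (wkμ t) ≡ wkμ t
passArg-wkμ v t = sub∘ren t (λ _ → refl) (λ _ → refl)

passArg-β : ∀ {l k} (v : Λ l k) (u : Λ l (suc k)) →
            passArg v zero · u ⟶* αv zero · (u · wkμ v)
passArg-β {l} {k} v u = begin
    passArg v zero · u
  ⟶⟨ Cλ _ u ⟩
    (αv zero · (xv zero · wkλμ v)) [ u ]λ
  ≡⟨ cong (λ w → αv zero · (u · w)) (sub∘ren v (λ _ → refl) (λ _ → refl)) ⟩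
    αv zero · (u · wkμ v)
  ∎
  where open StarReasoning (_⟶_ {l} {suc k})

cont : ∀ {l k} → List (Λ l k) → Λ l (suc k)
cont us = lam (αv zero · apps (xv zero) (map wkλμ us))

cont-absorb : ∀ {l k} (us : List (Λ l k)) (v : Λ l k) → sub xv (passArg v) (cont us) ⟶* cont (us ∷ʳ v)
cont-absorb {l} {k} us v = begin
    sub xv (passArg v) (cont us)
  ≡⟨ cong (λ w → lam (wkλ (passArg v zero) · w))
          (trans (sub-apps _ _ (xv zero) (map wkλμ us))
                 (cong (apps (xv zero)) (map-sub∘ren (λ _ → refl) (λ _ → refl) us))) ⟩
    lam (wkλ (passArg v zero) · apps (xv zero) (map wkλμ us))
  ⟶⟨ ξλ (Cλ _ _) ⟩
    lam ((αv zero · (xv zero · v′)) [ apps (xv zero) (map wkλμ us) ]λ)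
  ≡⟨ cong (λ w → lam (αv zero · (apps (xv zero) (map wkλμ us) · w))) v′-fixed ⟩
    lam (αv zero · (apps (xv zero) (map wkλμ us) · wkλμ v))
  ≡⟨ cong (λ w → lam (αv zero · w)) (sym (apps-map-∷ʳ wkλμ (xv zero) us v)) ⟩
    cont (us ∷ʳ v)
  ∎
  where
  open StarReasoning (_⟶_ {l} {suc k})
  v′ : Λ (suc (suc l)) (suc k)
  v′ = ren (liftF suc) id (wkλμ v)
  v′-fixed : v′ [ apps (xv zero) (map wkλμ us) ]λ ≡ wkλμ v
  v′-fixed = trans (cong _[ apps (xv zero) (map wkλμ us) ]λ (ren∘ren v (λ _ → refl) (λ _ → refl)))
                   (sub∘ren v (λ _ → refl) (λ _ → refl))

μwkμ-absorb : ∀ {l k} (t v : Λ l k) → mu (wkμ t) · v ⟶* mu (wkμ t)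
μwkμ-absorb {l} {k} t v = begin
    mu (wkμ t) · v
  ⟶⟨ Cμ-passArg (wkμ t) v ⟩
    mu (sub xv (passArg v) (wkμ t))
  ≡⟨ cong mu (passArg-wkμ v t) ⟩
    mu (wkμ t)
  ∎
  where open StarReasoning (_⟶_ {l} {k})

𝓘-reduces : ∀ {l k} (t : Λ l k) (ts : List (Λ l k)) → apps 𝓘 (t ∷ ts) ⟶* mu (wkμ t)
𝓘-reduces t ts = apps-⟶ ts (Cλ _ t) ◅ apps-absorb (λ _ → mu (wkμ t)) (λ _ → μwkμ-absorb t) [] ts

𝓒-reduct : ∀ {l k} → Λ l k → List (Λ l k) → Λ l k
𝓒-reduct t us = mu (wkμ t · cont us)

𝓒-reduct-absorb : ∀ {l k} (t : Λ l k) (us : List (Λ l k)) (v : Λ l k) →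
                  𝓒-reduct t us · v ⟶* 𝓒-reduct t (us ∷ʳ v)
𝓒-reduct-absorb {l} {k} t us v = begin
    𝓒-reduct t us · v
  ⟶⟨ Cμ-passArg _ v ⟩
    mu (sub xv (passArg v) (wkμ t) · sub xv (passArg v) (cont us))
  ≡⟨ cong (λ w → mu (w · sub xv (passArg v) (cont us))) (passArg-wkμ v t) ⟩
    mu (wkμ t · sub xv (passArg v) (cont us))
  ⟶*⟨ gmap (λ w → mu (wkμ t · w)) (ξμ ∘ ξ·ᵣ) (cont-absorb us v) ⟩
    𝓒-reduct t (us ∷ʳ v)
  ∎
  where open StarReasoning (_⟶_ {l} {k})

𝓒-reduces : ∀ {l k} (t t₁ : Λ l k) (ts : List (Λ l k)) → apps 𝓒 (t ∷ t₁ ∷ ts) ⟶* 𝓒-reduct t (t₁ ∷ ts)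
𝓒-reduces {l} {k} t t₁ ts = apps-⟶* ts first-two ◅◅ apps-absorb (𝓒-reduct t) (𝓒-reduct-absorb t) [ t₁ ] ts
  where
  open StarReasoning (_⟶_ {l} {k})
  first-two : 𝓒 · t · t₁ ⟶* 𝓒-reduct t [ t₁ ]
  first-two = begin
      𝓒 · t · t₁
    ⟶⟨ ξ·ₗ (Cλ _ t) ⟩
      mu (wkμ t · αv zero) · t₁
    ⟶⟨ Cμ-passArg _ t₁ ⟩
      mu (sub xv (passArg t₁) (wkμ t) · passArg t₁ zero)
    ≡⟨ cong (λ w → mu (w · passArg t₁ zero)) (passArg-wkμ t₁ t) ⟩
      𝓒-reduct t [ t₁ ]
    ∎

𝓟-reduct : ∀ {l k} → Λ l k → List (Λ l k) → Λ l k
𝓟-reduct t us = mu (αv zero · apps (wkμ t · cont us) (map wkμ us))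

𝓟-reduct-absorb : ∀ {l k} (t : Λ l k) (us : List (Λ l k)) (v : Λ l k) →
                  𝓟-reduct t us · v ⟶* 𝓟-reduct t (us ∷ʳ v)
𝓟-reduct-absorb {l} {k} t us v = begin
    𝓟-reduct t us · v
  ⟶⟨ Cμ-passArg _ v ⟩
    mu (passArg v zero · sub xv (passArg v) (apps (wkμ t · cont us) (map wkμ us)))
  ≡⟨ cong (λ w → mu (passArg v zero · w)) body-fixed ⟩
    mu (passArg v zero · apps (wkμ t · cont′) (map wkμ us))
  ⟶*⟨ gmap mu ξμ (passArg-β v _) ⟩
    mu (αv zero · (apps (wkμ t · cont′) (map wkμ us) · wkμ v))
  ≡⟨ cong (λ w → mu (αv zero · w)) (sym (apps-map-∷ʳ wkμ (wkμ t · cont′) us v)) ⟩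
    mu (αv zero · apps (wkμ t · cont′) (map wkμ (us ∷ʳ v)))
  ⟶*⟨ gmap (λ w → mu (αv zero · apps (wkμ t · w) (map wkμ (us ∷ʳ v))))
           (λ p → ξμ (ξ·ᵣ (apps-⟶ (map wkμ (us ∷ʳ v)) (ξ·ᵣ p))))
           (cont-absorb us v) ⟩
    𝓟-reduct t (us ∷ʳ v)
  ∎
  where
  open StarReasoning (_⟶_ {l} {k})
  cont′ : Λ l (suc k)
  cont′ = sub xv (passArg v) (cont us)
  body-fixed : sub xv (passArg v) (apps (wkμ t · cont us) (map wkμ us)) ≡ apps (wkμ t · cont′) (map wkμ us)
  body-fixed = trans (sub-apps xv (passArg v) (wkμ t · cont us) (map wkμ us))
                     (cong₂ (λ w ws → apps (w · cont′) ws)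
                            (passArg-wkμ v t) (map-sub∘ren (λ _ → refl) (λ _ → refl) us))

𝓟-reduces : ∀ {l k} (t t₁ : Λ l k) (ts : List (Λ l k)) → apps 𝓟 (t ∷ t₁ ∷ ts) ⟶* 𝓟-reduct t (t₁ ∷ ts)
𝓟-reduces {l} {k} t t₁ ts = apps-⟶* ts first-two ◅◅ apps-absorb (𝓟-reduct t) (𝓟-reduct-absorb t) [ t₁ ] ts
  where
  open StarReasoning (_⟶_ {l} {k})
  first-two : 𝓟 · t · t₁ ⟶* 𝓟-reduct t [ t₁ ]
  first-two = begin
      𝓟 · t · t₁
    ⟶⟨ ξ·ₗ (Cλ _ t) ⟩
      mu (αv zero · (wkμ t · αv zero)) · t₁
    ⟶⟨ Cμ-passArg _ t₁ ⟩
      mu (passArg t₁ zero · (sub xv (passArg t₁) (wkμ t) · passArg t₁ zero))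
    ≡⟨ cong (λ w → mu (passArg t₁ zero · (w · passArg t₁ zero))) (passArg-wkμ t₁ t) ⟩
      mu (passArg t₁ zero · (wkμ t · cont [ t₁ ]))
    ⟶*⟨ gmap mu ξμ (passArg-β t₁ _) ⟩
      𝓟-reduct t [ t₁ ]
    ∎

theorem9 : (E : Eqs) →
      (Typed E ∅ ∅ 𝓘 (∀₂ 0 (⊥' ⇒ X₀))
        × (∀ {l k} (t : Λ l k) (ts : List (Λ l k)) →
             apps 𝓘 (t ∷ ts) ⟶* mu (wkμ t)))
    × (Typed E ∅ ∅ 𝓒 (∀₂ 0 (¬' (¬' X₀) ⇒ X₀))
        × (∀ {l k} (t t₁ : Λ l k) (ts : List (Λ l k)) →
             apps 𝓒 (t ∷ t₁ ∷ ts)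
               ⟶* mu (wkμ t · lam (αv zero · apps (xv zero) (map wkλμ (t₁ ∷ ts))))))
    × (Typed E ∅ ∅ 𝓟 (∀₂ 0 ((¬' X₀ ⇒ X₀) ⇒ X₀))
        × (∀ {l k} (t t₁ : Λ l k) (ts : List (Λ l k)) →
             apps 𝓟 (t ∷ t₁ ∷ ts)
               ⟶* mu (αv zero · apps (wkμ t · lam (αv zero · apps (xv zero) (map wkλμ (t₁ ∷ ts))))
                                      (map wkμ (t₁ ∷ ts)))))
theorem9 E =
    (∀₂I (→I (μI (axx zero))) , 𝓘-reduces)
  , (∀₂I (→I (μI (→E (axx zero) (axα zero)))) , 𝓒-reduces)
  , (∀₂I (→I (μI (→E (axα zero) (→E (axx zero) (axα zero))))) , 𝓟-reduces)
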